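{- Let $G$ be a graph of order $n$ with $\gamma_i(G)\ge 2$ and minimum degree $\delta(G)$. Then $st_{id}(G)\le \min\{\delta(G)+1,\ n-\delta(G)-1\}$.
   Context: All graphs are finite and simple. An independent dominating set of a graph $G$ is a set $S\subseteq V(G)$ of pairwise non-adjacent vertices such that every vertex not in $S$ has a neighbour in $S$. The independent domination number $\gamma_i(G)$ is the minimum size of an independent dominating set (for the null graph with no vertices, $\gamma_i=0$). The independent domination stability $st_{id}(G)$ is the minimum number of vertices whose removal from $G$ yields a graph with independent domination number different from $\gamma_i(G)$. -}

module Defs where

open import Data.Nat using (ℕ; _≤_)
open import Data.Bool using (Bool; true; false)
open import Data.Fin using (Fin)
open import Data.Fin.Subset using (Subset; _∈_; _∉_; _⊆_; ∣_∣; ∁; ⊤)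
open import Data.Vec using (tabulate)
open import Data.Product using (Σ; ∃; _×_; _,_)
open import Relation.Binary.PropositionalEquality using (_≡_)

record Graph (n : ℕ) : Set where
  field
    adj   : Fin n → Fin n → Bool
    sym   : ∀ u v → adj u v ≡ adj v u
    irrefl : ∀ v → adj v v ≡ false
open Graph public

N : ∀ {n} → Graph n → Fin n → Subset n
N G v = tabulate (adj G v)

degree : ∀ {n} → Graph n → Fin n → ℕ
degree G v = ∣ N G v ∣

IsMinDegree : ∀ {n} → Graph n → ℕ → Set
IsMinDegree G d = (∃ λ v → degree G v ≡ d) × (∀ v → d ≤ degree G v)

-- S is an independent dominating set of the induced subgraph G[U]
IsIDS : ∀ {n} → Graph n → Subset n → Subset n → Set
IsIDS G U S =
  S ⊆ U
  × (∀ x y → x ∈ S → y ∈ S → adj G x y ≡ false)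
  × (∀ v → v ∈ U → v ∉ S → ∃ λ u → u ∈ S × adj G v u ≡ true)

IsIndDomNum : ∀ {n} → Graph n → Subset n → ℕ → Set
IsIndDomNum G U k =
  (∃ λ S → IsIDS G U S × ∣ S ∣ ≡ k) × (∀ S → IsIDS G U S → k ≤ ∣ S ∣)

IsIndDomNumG : ∀ {n} → Graph n → ℕ → Set
IsIndDomNumG G k = IsIndDomNum G ⊤ k

-- G - R is the induced subgraph on ∁ R.
-- st_id(G) = s : minimum number of removed vertices changing γ_i
Changes : ∀ {n} → Graph n → Subset n → Set
Changes G R = ∃ λ k → ∃ λ k' → IsIndDomNumG G k × IsIndDomNum G (∁ R) k' × (k' ≡ k → Data.Empty.⊥)
  where import Data.Empty

IsStId : ∀ {n} → Graph n → ℕ → Set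
IsStId G s = (∃ λ R → Changes G R × ∣ R ∣ ≡ s) × (∀ R → Changes G R → s ≤ ∣ R ∣)

-- Let v be a vertex of minimum degree δ and N[v] = N(v) ∪ {v} its closed
-- neighbourhood. Removing everything outside N[v] leaves a graph in which v
-- dominates alone, so γ_i drops to 1 < γ_i(G) after n − δ − 1 deletions.
-- Removing N(v) leaves v isolated; if that does not already change γ_i, then
-- every minimum independent dominating set of G − N(v) contains v, and
-- deleting v from it dominates G − N[v], so removing the δ + 1 vertices of
-- N[v] lowers γ_i.
module Submission where

open import Defs hiding (sym)
open import Data.Nat using (ℕ; suc; _+_; _∸_; _⊓_; _≤_; _<_; z≤n; s≤s; _≟_)
open import Data.Nat.Properties
  using ( ≤-reflexive; ≤-trans; ≤-antisym; ≮⇒≥; <⇒≢; <⇒≱; ≤-<-trans; n≤1+n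
        ; ⊓-glb; ∸-+-assoc; +-comm)
open import Data.Nat.Induction using (<-rec)
open import Data.Bool using (true; false)
import Data.Bool as Bool
open import Data.Bool.Properties using (¬-not)
open import Data.Fin using (Fin; toℕ; fromℕ<)
import Data.Fin as Fin
open import Data.Fin.Properties using (any?; all?; toℕ<n; toℕ-fromℕ<)
open import Data.Fin.Subset
  using (Subset; _∈_; _∉_; _⊆_; ∣_∣; ∁; ⊤; _∪_; _─_; _-_; ⁅_⁆; inside; outside)
open import Data.Fin.Subset.Properties
open import Data.Vec using (_∷_; []; here; there)
open import Data.Vec.Properties using ([]=⇒lookup; lookup⇒[]=; lookup∘tabulate)
open import Data.Product using (∃; _×_; _,_; proj₁; proj₂)
open import Data.Sum using (_⊎_; inj₁; inj₂; [_,_])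
open import Function using (_∘_)
open import Relation.Nullary using (Dec; yes; no; contradiction)
open import Relation.Nullary.Decidable using (_×-dec_; _→-dec_; ¬?)
open import Relation.Unary using (Decidable)
open import Relation.Binary.PropositionalEquality
  using (_≡_; _≢_; refl; sym; trans; cong; subst; subst₂; module ≡-Reasoning)

Least : (ℕ → Set) → ℕ → Set
Least P m = P m × (∀ {j} → P j → m ≤ j)

least : (P : ℕ → Set) → Decidable P → ∀ {a} → P a → ∃ (Least P)
least P P? = <-rec (λ a → P a → ∃ (Least P)) step _
  where
  step : ∀ a → (∀ {b} → b < a → P b → ∃ (Least P)) → P a → ∃ (Least P)
  step a rec pa with any? (λ (j : Fin a) → P? (toℕ j))
  ... | yes (j , pj) = rec (toℕ<n j) pj
  ... | no none = a , pa , λ {j} pj →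
    ≮⇒≥ (λ j<a → none (fromℕ< j<a , subst P (sym (toℕ-fromℕ< j<a)) pj))

IsMinCard : ∀ {n} → (Subset n → Set) → ℕ → Set
IsMinCard Q m = (∃ λ S → Q S × ∣ S ∣ ≡ m) × (∀ S → Q S → m ≤ ∣ S ∣)

minCard-exists : ∀ {n} {Q : Subset n → Set} → Decidable Q → ∃ Q → ∃ (IsMinCard Q)
minCard-exists {Q = Q} Q? (S , qS)
  with least (λ j → ∃ λ S → Q S × ∣ S ∣ ≡ j)
             (λ j → anySubset? (λ S → Q? S ×-dec (∣ S ∣ ≟ j)))
             (S , qS , refl)
... | m , witness , minimal = m , witness , λ T qT → minimal (T , qT , refl)

minCard-unique : ∀ {n} {Q : Subset n → Set} {m m'} → IsMinCard Q m → IsMinCard Q m' → m ≡ m'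
minCard-unique ((S , qS , refl) , minimal) ((S' , qS' , refl) , minimal') =
  ≤-antisym (minimal S' qS') (minimal' S qS)

∁∁p≡p : ∀ {n} (p : Subset n) → ∁ (∁ p) ≡ p
∁∁p≡p p = ⊆-antisym (x∉∁p⇒x∈p ∘ x∈∁p⇒x∉p) (x∉p⇒x∈∁p ∘ x∈p⇒x∉∁p)

∁[p∪q]≡∁p─q : ∀ {n} (p q : Subset n) → ∁ (p ∪ q) ≡ ∁ p ─ q
∁[p∪q]≡∁p─q []            []            = refl
∁[p∪q]≡∁p─q (inside  ∷ p) (inside  ∷ q) = cong (outside ∷_) (∁[p∪q]≡∁p─q p q)
∁[p∪q]≡∁p─q (inside  ∷ p) (outside ∷ q) = cong (outside ∷_) (∁[p∪q]≡∁p─q p q)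
∁[p∪q]≡∁p─q (outside ∷ p) (inside  ∷ q) = cong (outside ∷_) (∁[p∪q]≡∁p─q p q)
∁[p∪q]≡∁p─q (outside ∷ p) (outside ∷ q) = cong (inside ∷_) (∁[p∪q]≡∁p─q p q)

x∈p─q⇒x∉q : ∀ {n} (p q : Subset n) {x} → x ∈ p ─ q → x ∉ q
x∈p─q⇒x∉q (_ ∷ p) (outside ∷ q) here        ()
x∈p─q⇒x∉q (_ ∷ p) (_       ∷ q) (there x∈) (there x∈q) = x∈p─q⇒x∉q p q x∈ x∈q

x∈p-y⇒x≢y : ∀ {n} {p : Subset n} {x y} → x ∈ p - y → x ≢ y
x∈p-y⇒x≢y {p = p} {y = y} x∈ = x∉⁅y⁆⇒x≢y (x∈p─q⇒x∉q p ⁅ y ⁆ x∈)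

∣p∪⁅x⁆∣≡1+∣p∣ : ∀ {n} {p : Subset n} {x} → x ∉ p → ∣ p ∪ ⁅ x ⁆ ∣ ≡ suc ∣ p ∣
∣p∪⁅x⁆∣≡1+∣p∣ {p = inside  ∷ p} {Fin.zero} x∉p = contradiction here x∉p
∣p∪⁅x⁆∣≡1+∣p∣ {p = outside ∷ p} {Fin.zero} _   = cong suc (cong ∣_∣ (∪-identityʳ p))
∣p∪⁅x⁆∣≡1+∣p∣ {p = inside  ∷ p} {Fin.suc x} x∉p = cong suc (∣p∪⁅x⁆∣≡1+∣p∣ (x∉p ∘ there))
∣p∪⁅x⁆∣≡1+∣p∣ {p = outside ∷ p} {Fin.suc x} x∉p = ∣p∪⁅x⁆∣≡1+∣p∣ (x∉p ∘ there)

∈p⇒1≤∣p∣ : ∀ {n} {p : Subset n} {x} → x ∈ p → 1 ≤ ∣ p ∣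
∈p⇒1≤∣p∣ x∈p = ≤-trans (s≤s z≤n) (x∈p⇒∣p-x∣<∣p∣ x∈p)

module _ {n : ℕ} (G : Graph n) where

  adj⇒∈N : ∀ {v u} → adj G v u ≡ true → u ∈ N G v
  adj⇒∈N {v} {u} e = lookup⇒[]= u (N G v) (trans (lookup∘tabulate (adj G v) u) e)

  ∈N⇒adj : ∀ {v u} → u ∈ N G v → adj G v u ≡ true
  ∈N⇒adj {v} {u} u∈ = trans (sym (lookup∘tabulate (adj G v) u)) ([]=⇒lookup u∈)

  adj-sym : ∀ {u v} → adj G u v ≡ true → adj G v u ≡ true
  adj-sym {u} {v} e = trans (Graph.sym G v u) e

  v∉N : ∀ v → v ∉ N G v
  v∉N v v∈ with trans (sym (∈N⇒adj v∈)) (irrefl G v)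
  ... | ()

  IsIndependent : Subset n → Subset n → Set
  IsIndependent U S = S ⊆ U × (∀ x y → x ∈ S → y ∈ S → adj G x y ≡ false)

  nonAdjacent? : ∀ S → Dec (∀ x y → x ∈ S → y ∈ S → adj G x y ≡ false)
  nonAdjacent? S = all? λ x → all? λ y → (x ∈? S) →-dec (y ∈? S) →-dec (adj G x y Bool.≟ false)

  dominates? : ∀ U S → Dec (∀ v → v ∈ U → v ∉ S → ∃ λ u → u ∈ S × adj G v u ≡ true)
  dominates? U S = all? λ v → (v ∈? U) →-dec ¬? (v ∈? S) →-dec
                     any? λ u → (u ∈? S) ×-dec (adj G v u Bool.≟ true)

  independent? : ∀ U → Decidable (IsIndependent U)
  independent? U S = (S ⊆? U) ×-dec nonAdjacent? S

  isIDS? : ∀ U → Decidable (IsIDS G U)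
  isIDS? U S = (S ⊆? U) ×-dec nonAdjacent? S ×-dec dominates? U S

  independent-∪⁅⁆ : ∀ {U S v} → IsIndependent U S → v ∈ U →
                    (∀ u → u ∈ S → adj G v u ≡ false) → IsIndependent U (S ∪ ⁅ v ⁆)
  independent-∪⁅⁆ {U} {S} {v} (S⊆U , nonAdj) v∈U v≁S = S'⊆U , nonAdj'
    where
    split : ∀ {x} → x ∈ S ∪ ⁅ v ⁆ → x ∈ S ⊎ x ≡ v
    split x∈ with x∈p∪q⁻ S ⁅ v ⁆ x∈
    ... | inj₁ x∈S = inj₁ x∈S
    ... | inj₂ x∈v = inj₂ (x∈⁅y⁆⇒x≡y v x∈v)
    S'⊆U : S ∪ ⁅ v ⁆ ⊆ U
    S'⊆U x∈ with split x∈
    ... | inj₁ x∈S = S⊆U x∈S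
    ... | inj₂ refl = v∈U
    nonAdj' : ∀ x y → x ∈ S ∪ ⁅ v ⁆ → y ∈ S ∪ ⁅ v ⁆ → adj G x y ≡ false
    nonAdj' x y x∈ y∈ with split x∈ | split y∈
    ... | inj₁ x∈S | inj₁ y∈S = nonAdj x y x∈S y∈S
    ... | inj₂ refl | inj₁ y∈S = v≁S y y∈S
    ... | inj₁ x∈S | inj₂ refl = trans (Graph.sym G x v) (v≁S x x∈S)
    ... | inj₂ refl | inj₂ refl = irrefl G v

  ∁⊤-independent : ∀ U → IsIndependent U (∁ ⊤)
  ∁⊤-independent U = (λ x∈ → contradiction ∈⊤ (x∈∁p⇒x∉p x∈))
                   , (λ x y x∈ _ → contradiction ∈⊤ (x∈∁p⇒x∉p x∈))

  -- A maximum independent set is dominating; it is taken as the complement ∁ T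
  -- of a smallest T with ∁ T independent, so that minCard-exists applies.
  ids-exists : ∀ U → ∃ (IsIDS G U)
  ids-exists U with minCard-exists (λ T → independent? U (∁ T)) (⊤ , ∁⊤-independent U)
  ... | _ , (T , (S⊆U , nonAdj) , refl) , minimal = ∁ T , S⊆U , nonAdj , dominated
    where
    dominated : ∀ v → v ∈ U → v ∉ ∁ T → ∃ λ u → u ∈ ∁ T × adj G v u ≡ true
    dominated v v∈U v∉S with any? (λ u → (u ∈? ∁ T) ×-dec (adj G v u Bool.≟ true))
    ... | yes found = found
    ... | no none = contradiction (minimal (∁ S') T'-ok) (<⇒≱ ∣T'∣<∣T∣)
      where
      S' = ∁ T ∪ ⁅ v ⁆
      T'-ok : IsIndependent U (∁ (∁ S'))
      T'-ok = subst (IsIndependent U) (sym (∁∁p≡p S'))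
                (independent-∪⁅⁆ (S⊆U , nonAdj) v∈U (λ u u∈ → ¬-not (λ e → none (u , u∈ , e))))
      ∣T'∣<∣T∣ : ∣ ∁ S' ∣ < ∣ T ∣
      ∣T'∣<∣T∣ = subst (∣ ∁ S' ∣ <_) (cong ∣_∣ (∁∁p≡p T))
                  (p⊂q⇒∣p∣<∣q∣ (p⊂q⇒∁p⊃∁q (p⊆p∪q ⁅ v ⁆ , v , x∈p∪q⁺ (inj₂ (x∈⁅x⁆ v)) , v∉S)))

  indDomNum-exists : ∀ U → ∃ (IsIndDomNum G U)
  indDomNum-exists U = minCard-exists (isIDS? U) (ids-exists U)

  changes? : Decidable (Changes G)
  changes? R with indDomNum-exists ⊤ | indDomNum-exists (∁ R)
  ... | k , γ | k' , γ' with k' ≟ k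
  ... | no k'≢k = yes (k , k' , γ , γ' , k'≢k)
  ... | yes k'≡k = no λ (j , j' , γj , γj' , j'≢j) →
    j'≢j (trans (minCard-unique γj' γ') (trans k'≡k (minCard-unique γ γj)))

  stId-exists : ∀ {R} → Changes G R → ∃ λ s → IsStId G s × s ≤ ∣ R ∣
  stId-exists {R} changes =
    let s , st = minCard-exists changes? (R , changes) in s , st , proj₂ st R changes

  Isolated : Subset n → Fin n → Set
  Isolated U v = ∀ {u} → u ∈ U → adj G v u ≡ false

  isolated∈ids : ∀ {U S v} → v ∈ U → Isolated U v → IsIDS G U S → v ∈ S
  isolated∈ids {S = S} {v} v∈U isolated (S⊆U , _ , dominated) with v ∈? S
  ... | yes v∈S = v∈S
  ... | no v∉S with dominated v v∈U v∉S
  ... | u , u∈S , v~u = contradiction (trans (sym v~u) (isolated (S⊆U u∈S))) λ ()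

  ids-deleteIsolated : ∀ {U S v} → Isolated U v → IsIDS G U S → IsIDS G (U - v) (S - v)
  ids-deleteIsolated {U} {S} {v} isolated (S⊆U , nonAdj , dominated) =
      (λ x∈ → x∈p∧x≢y⇒x∈p-y (S⊆U (p─q⊆p S ⁅ v ⁆ x∈)) (x∈p-y⇒x≢y x∈))
    , (λ x y x∈ y∈ → nonAdj x y (p─q⊆p S ⁅ v ⁆ x∈) (p─q⊆p S ⁅ v ⁆ y∈))
    , dominated'
    where
    dominated' : ∀ w → w ∈ U - v → w ∉ S - v → ∃ λ u → u ∈ S - v × adj G w u ≡ true
    dominated' w w∈ w∉ = avoid-v (dominated w w∈U (w∉ ∘ λ w∈S → x∈p∧x≢y⇒x∈p-y w∈S (x∈p-y⇒x≢y w∈)))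
      where
      w∈U = p─q⊆p U ⁅ v ⁆ w∈
      avoid-v : ∃ (λ u → u ∈ S × adj G w u ≡ true) → ∃ λ u → u ∈ S - v × adj G w u ≡ true
      avoid-v (u , u∈S , w~u) = u , x∈p∧x≢y⇒x∈p-y u∈S u≢v , w~u
        where
        u≢v : u ≢ v
        u≢v refl = contradiction (trans (sym (isolated w∈U)) (trans (Graph.sym G v w) w~u)) λ ()

  indDomNum-deleteIsolated : ∀ {U v k k'} → v ∈ U → Isolated U v →
                             IsIndDomNum G U k → IsIndDomNum G (U - v) k' → k' < k
  indDomNum-deleteIsolated v∈U isolated ((S , ids , refl) , _) (_ , minimal') =
    ≤-<-trans (minimal' _ (ids-deleteIsolated isolated ids))
              (x∈p⇒∣p-x∣<∣p∣ (isolated∈ids v∈U isolated ids))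

  ids-nonempty : ∀ {U S v} → v ∈ U → IsIDS G U S → 1 ≤ ∣ S ∣
  ids-nonempty {S = S} {v} v∈U (_ , _ , dominated) with v ∈? S
  ... | yes v∈S = ∈p⇒1≤∣p∣ v∈S
  ... | no v∉S = ∈p⇒1≤∣p∣ (proj₁ (proj₂ (dominated v v∈U v∉S)))

  Universal : Subset n → Fin n → Set
  Universal U v = ∀ {u} → u ∈ U → u ≢ v → adj G u v ≡ true

  indDomNum-universal : ∀ {U v} → v ∈ U → Universal U v → IsIndDomNum G U 1
  indDomNum-universal {U} {v} v∈U universal =
    (⁅ v ⁆ , ids , ∣⁅x⁆∣≡1 v) , λ S → ids-nonempty v∈U
    where
    ids : IsIDS G U ⁅ v ⁆
    ids = (λ x∈ → subst (_∈ U) (sym (x∈⁅y⁆⇒x≡y v x∈)) v∈U)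
        , (λ x y x∈ y∈ → subst₂ (λ a b → adj G a b ≡ false)
                           (sym (x∈⁅y⁆⇒x≡y v x∈)) (sym (x∈⁅y⁆⇒x≡y v y∈)) (irrefl G v))
        , λ w w∈U w∉ → v , x∈⁅x⁆ v , universal w∈U (x∉⁅y⁆⇒x≢y w∉)

  N[_] : Fin n → Subset n
  N[ v ] = N G v ∪ ⁅ v ⁆

  ∣N[v]∣≡1+degree : ∀ v → ∣ N[ v ] ∣ ≡ suc (degree G v)
  ∣N[v]∣≡1+degree v = ∣p∪⁅x⁆∣≡1+∣p∣ (v∉N v)

  ∣∁N[v]∣≡n∸degree∸1 : ∀ v → ∣ ∁ N[ v ] ∣ ≡ n ∸ degree G v ∸ 1
  ∣∁N[v]∣≡n∸degree∸1 v = begin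
    ∣ ∁ N[ v ] ∣          ≡⟨ ∣∁p∣≡n∸∣p∣ N[ v ] ⟩
    n ∸ ∣ N[ v ] ∣        ≡⟨ cong (n ∸_) (∣N[v]∣≡1+degree v) ⟩
    n ∸ suc (degree G v)  ≡⟨ cong (n ∸_) (+-comm 1 (degree G v)) ⟩
    n ∸ (degree G v + 1)  ≡⟨ ∸-+-assoc n (degree G v) 1 ⟨
    n ∸ degree G v ∸ 1    ∎
    where open ≡-Reasoning

  changes-∁N[v] : ∀ {k} v → IsIndDomNumG G k → 2 ≤ k → Changes G (∁ N[ v ])
  changes-∁N[v] v γ 2≤k =
    _ , 1 , γ , subst (λ U → IsIndDomNum G U 1) (sym (∁∁p≡p N[ v ])) γ[N[v]]≡1 , <⇒≢ 2≤k
    where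
    universal : Universal N[ v ] v
    universal u∈ u≢v with x∈p∪q⁻ (N G v) ⁅ v ⁆ u∈
    ... | inj₁ u∈N = adj-sym (∈N⇒adj u∈N)
    ... | inj₂ u∈v = contradiction (x∈⁅y⁆⇒x≡y v u∈v) u≢v
    γ[N[v]]≡1 : IsIndDomNum G N[ v ] 1
    γ[N[v]]≡1 = indDomNum-universal (x∈p∪q⁺ (inj₂ (x∈⁅x⁆ v))) universal

  changes-N⊎N[v] : ∀ {k} v → IsIndDomNumG G k → Changes G (N G v) ⊎ Changes G N[ v ]
  changes-N⊎N[v] {k} v γ with indDomNum-exists (∁ (N G v))
  ... | k₁ , γ₁ with k₁ ≟ k
  ... | no k₁≢k = inj₁ (k , k₁ , γ , γ₁ , k₁≢k)
  ... | yes refl with indDomNum-exists (∁ N[ v ])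
  ... | k₂ , γ₂ = inj₂ (k₁ , k₂ , γ , γ₂ , <⇒≢ k₂<k₁)
    where
    isolated : Isolated (∁ (N G v)) v
    isolated u∈ = ¬-not (x∈∁p⇒x∉p u∈ ∘ adj⇒∈N)
    k₂<k₁ : k₂ < k₁
    k₂<k₁ = indDomNum-deleteIsolated (x∉p⇒x∈∁p (v∉N v)) isolated γ₁
              (subst (λ U → IsIndDomNum G U k₂) (∁[p∪q]≡∁p─q (N G v) ⁅ v ⁆) γ₂)

  stId≤1+degree : ∀ {k s} v → IsIndDomNumG G k → IsStId G s → s ≤ suc (degree G v)
  stId≤1+degree v γ (_ , minimal) =
    [ (λ changes → ≤-trans (minimal _ changes) (n≤1+n _))
    , (λ changes → ≤-trans (minimal _ changes) (≤-reflexive (∣N[v]∣≡1+degree v)))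
    ] (changes-N⊎N[v] v γ)

mainTheorem11 : ∀ {n} (G : Graph n) (k δ : ℕ) → IsIndDomNumG G k → 2 ≤ k → IsMinDegree G δ →
    ∃ λ s → IsStId G s × s ≤ (suc δ ⊓ (n ∸ δ ∸ 1))
mainTheorem11 G k δ γ 2≤k ((v , refl) , _) =
  let s , st , s≤∣∁N[v]∣ = stId-exists G (changes-∁N[v] G v γ 2≤k) in
  s , st , ⊓-glb (stId≤1+degree G v γ st)
                 (≤-trans s≤∣∁N[v]∣ (≤-reflexive (∣∁N[v]∣≡n∸degree∸1 G v)))
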